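{- In a compact quadtree configuration $T$ there are at most three maximally empty $j$-pixels for every $j \in \mathbb{N}_0$.
   Context: The unit square $[0,1]^2$ is recursively subdivided as a quadtree of unbounded depth: the root (layer $0$) is $[0,1]^2$, and every node (pixel) of layer $j$ is an axis-parallel square of side $2^{ -j}$ whose four children are its four quadrants. A pixel of layer $j$ is a $j$-pixel. For $r\in\mathbb{N}_0$, an $r$-square is an axis-parallel square of side $2^{ -r}$. A (quadtree) configuration assigns finitely many squares to pixels, each $j$-square to a $j$-pixel, at most one square per pixel, such that no pixel with an assigned square is a proper descendant of another pixel with an assigned square. A pixel contains a square if it is assigned to it or to a descendant. A pixel with an assigned square is occupied; a non-occupied pixel is blocked if some ancestor is occupied, free otherwise; a free pixel is fractional if it contains a square and empty if it contains no square; an empty pixel is maximally empty if its parent is not empty (an empty root counts as maximally empty). A fractional pixel is open if at least one of its children is (maximally) empty. A configuration is compact if for every $j\in\mathbb{N}_0$ there is at most one open $j$-pixel. -}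

module Defs where

open import Data.Nat using (ℕ; _≤_)
open import Data.Fin using (Fin)
open import Data.List using (List; []; _∷_; _++_; [_]; length)
open import Data.List.Membership.Propositional using (_∈_)
open import Data.List.Relation.Unary.All using (All)
open import Data.List.Relation.Unary.Unique.Propositional using (Unique)
open import Data.Product using (Σ; ∃; _×_)
open import Data.Sum using (_⊎_)
open import Relation.Nullary using (¬_)
open import Relation.Binary.PropositionalEquality using (_≡_; _≢_)

-- A pixel is identified with its path from the root: the list of quadrant
-- choices (Fin 4) made going down.
Pixel : Set
Pixel = List (Fin 4)

layer : Pixel → ℕ
layer = length

child : Pixel → Fin 4 → Pixel
child p i = p ++ [ i ]

_≼_ : Pixel → Pixel → Set
p ≼ q = ∃ λ s → p ++ s ≡ q

_≺_ : Pixel → Pixel → Set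
p ≺ q = ∃ λ s → s ≢ [] × p ++ s ≡ q

-- A configuration is recorded by the (finite) list of pixels to which a square
-- is assigned; a j-square is assigned to a j-pixel, so the square of an
-- occupied pixel p is determined (up to its irrelevant identity) by layer p.
Config : Set
Config = List Pixel

IsConfig : Config → Set
IsConfig C = Unique C × (∀ {o o'} → o ∈ C → o' ∈ C → ¬ (o ≺ o'))

module _ (C : Config) where

  Occupied : Pixel → Set
  Occupied p = p ∈ C

  Contains : Pixel → Set
  Contains p = ∃ λ o → o ∈ C × p ≼ o

  Blocked : Pixel → Set
  Blocked p = ¬ Occupied p × (∃ λ o → o ∈ C × o ≺ p)

  Free : Pixel → Set
  Free p = ¬ Occupied p × ¬ Blocked p

  Fractional : Pixel → Set
  Fractional p = Free p × Contains p

  Empty : Pixel → Set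
  Empty p = Free p × ¬ Contains p

  MaxEmpty : Pixel → Set
  MaxEmpty p = Empty p × (p ≡ [] ⊎ (∃ λ q → ∃ λ i → p ≡ child q i × ¬ Empty q))

  Open : Pixel → Set
  Open p = Fractional p × (∃ λ i → MaxEmpty (child p i))

  Compact : Set
  Compact = ∀ j p q → layer p ≡ j → layer q ≡ j → Open p → Open q → p ≡ q

  AtMostThreeMaxEmpty : ℕ → Set
  AtMostThreeMaxEmpty j =
    ∀ (ps : List Pixel) → Unique ps →
      All (λ p → layer p ≡ j × MaxEmpty p) ps → length ps ≤ 3

-- The parent of a maximally empty j-pixel (j ≥ 1) is free and non-empty, hence
-- fractional, and it is open because that child is maximally empty.  By
-- compactness all maximally empty j-pixels therefore share one parent q.  Since
-- q is not itself occupied, the square it contains lies in one of its children,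
-- which is then not empty; so at most three of the four children of q are
-- maximally empty.  Layer 0 consists of the root alone.
module Submission where

open import Defs
open import Data.Nat using (ℕ; zero; suc; _≤_; z≤n; s≤s)
open import Data.Nat.Properties using (suc-injective; +-comm; ≤-trans; ≤-pred; module ≤-Reasoning)
open import Data.Fin using (Fin)
open import Data.Fin.Properties using (_≟_)
open import Data.List using (List; []; _∷_; _++_; [_]; length; map; allFin)
open import Data.List.Properties using (length-++; length-removeAt′; ++-assoc; ++-identityʳ; ++-conicalʳ)
open import Data.List.Membership.Propositional using (_∈_; _─_; find; lose)
open import Data.List.Membership.Propositional.Properties using (∈-map⁺; ∈-allFin)
open import Data.List.Relation.Binary.Subset.Propositional using (_⊆_)
open import Data.List.Relation.Binary.Prefix.Heterogeneous.Properties using (prefix?)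
open import Data.List.Relation.Binary.Prefix.Propositional.Properties using (Prefix-as-∣ˡ; ∣ˡ-as-Prefix)
open import Data.List.Relation.Unary.Any using (here; there; index; any?)
open import Data.List.Relation.Unary.All as All using (All; _∷_)
open import Data.List.Relation.Unary.AllPairs using (_∷_)
open import Data.List.Relation.Unary.Unique.Propositional using (Unique)
open import Data.Product using (∃; ∃₂; _×_; _,_; proj₁; proj₂)
open import Data.Sum using (inj₁; inj₂)
open import Data.Empty using (⊥-elim)
open import Relation.Nullary using (¬_; yes; no)
open import Relation.Nullary.Decidable using (map′)
open import Relation.Unary using (Decidable)
open import Algebra.Definitions.RawMagma using (_∣ˡ_)
open import Relation.Binary.Definitions using () renaming (Decidable to Decidable₂)
open import Relation.Binary.PropositionalEquality using (_≡_; _≢_; refl; sym; trans; cong; subst; module ≡-Reasoning)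

module _ {a} {A : Set a} where

  ∈-─⁺ : ∀ {x y : A} {ys} (x∈ys : x ∈ ys) → y ∈ ys → x ≢ y → y ∈ ys ─ x∈ys
  ∈-─⁺ (here refl)  (here refl)  x≢y = ⊥-elim (x≢y refl)
  ∈-─⁺ (here refl)  (there y∈ys) _   = y∈ys
  ∈-─⁺ (there _)    (here refl)  _   = here refl
  ∈-─⁺ (there x∈ys) (there y∈ys) x≢y = there (∈-─⁺ x∈ys y∈ys x≢y)

  Unique∧⊆⇒length≤ : ∀ {xs ys : List A} → Unique xs → xs ⊆ ys → length xs ≤ length ys
  Unique∧⊆⇒length≤ {[]}     _            _     = z≤n
  Unique∧⊆⇒length≤ {x ∷ xs} {ys} (x∉xs ∷ xs!) xs⊆ys = begin
    suc (length xs)          ≤⟨ s≤s (Unique∧⊆⇒length≤ xs! xs⊆ys─x) ⟩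
    suc (length (ys ─ x∈ys)) ≡⟨ length-removeAt′ ys (index x∈ys) ⟨
    length ys                ∎
    where
    open ≤-Reasoning
    x∈ys : x ∈ ys
    x∈ys = xs⊆ys (here refl)
    xs⊆ys─x : xs ⊆ ys ─ x∈ys
    xs⊆ys─x y∈xs = ∈-─⁺ x∈ys (xs⊆ys (there y∈xs)) (All.lookup x∉xs y∈xs)

layer-child : ∀ q i → layer (child q i) ≡ suc (layer q)
layer-child q i = trans (length-++ q) (+-comm (layer q) 1)

children : Pixel → List Pixel
children q = map (child q) (allFin 4)

-- p ≼ o is literally left divisibility in the monoid (List, _++_, []).
_≼?_ : Decidable₂ _≼_
p ≼? o = map′ (λ p⊑o → let open _∣ˡ_ (Prefix-as-∣ˡ p⊑o) in quotient , equality)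
              (λ (s , e) → ∣ˡ-as-Prefix record { quotient = s ; equality = e })
              (prefix? _≟_ p o)

module _ (C : Config) where

  contains? : Decidable (Contains C)
  contains? p = map′ find (λ (o , o∈C , p≼o) → lose o∈C p≼o) (any? (p ≼?_) C)

  free-parent : ∀ q i → Free C (child q i) → Free C q
  free-parent q i (qi∉C , qi-unblocked) = q∉C , q-unblocked
    where
    q∉C : ¬ Occupied C q
    q∉C q∈C = qi-unblocked (qi∉C , q , q∈C , [ i ] , (λ ()) , refl)
    q-unblocked : ¬ Blocked C q
    q-unblocked (_ , o , o∈C , s , _ , o++s≡q) =
      qi-unblocked (qi∉C , o , o∈C , s ++ [ i ] , s++[i]≢[] , o++s++i≡qi)
      where
      s++[i]≢[] : s ++ [ i ] ≢ []
      s++[i]≢[] e with () ← ++-conicalʳ s [ i ] e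
      o++s++i≡qi : o ++ (s ++ [ i ]) ≡ child q i
      o++s++i≡qi = begin
        o ++ (s ++ [ i ]) ≡⟨ ++-assoc o s [ i ] ⟨
        (o ++ s) ++ [ i ] ≡⟨ cong (_++ [ i ]) o++s≡q ⟩
        q ++ [ i ]        ∎
        where open ≡-Reasoning

  maxEmpty⇒parent-open : ∀ {x j} → layer x ≡ suc j → MaxEmpty C x →
                         ∃₂ λ q i → x ≡ child q i × layer q ≡ j × Open C q
  maxEmpty⇒parent-open () (_ , inj₁ refl)
  maxEmpty⇒parent-open lx mx@(qi-empty , inj₂ (q , i , refl , q-nonempty)) =
    q , i , refl , suc-injective (trans (sym (layer-child q i)) lx) , (q-fractional , i , mx)
    where
    q-free : Free C q
    q-free = free-parent q i (proj₁ qi-empty)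
    q-fractional : Fractional C q
    q-fractional with contains? q
    ... | yes c  = q-free , c
    ... | no ¬c  = ⊥-elim (q-nonempty (q-free , ¬c))

  fractional⇒child-contains : ∀ {q} → Fractional C q → ∃ λ k → Contains C (child q k)
  fractional⇒child-contains {q} ((q∉C , _) , o , o∈C , [] , q++[]≡o) =
    ⊥-elim (q∉C (subst (_∈ C) (trans (sym q++[]≡o) (++-identityʳ q)) o∈C))
  fractional⇒child-contains {q} (_ , o , o∈C , k ∷ s , q++ks≡o) =
    k , o , o∈C , s , trans (++-assoc q [ k ] s) q++ks≡o

  compact⇒maxEmpty∈children : Compact C → ∀ {q x} → Open C q →
                              layer x ≡ suc (layer q) → MaxEmpty C x → x ∈ children q
  compact⇒maxEmpty∈children compact {q} q-open lx mx with maxEmpty⇒parent-open lx mx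
  ... | q′ , i , refl , lq′ , q′-open rewrite compact (layer q) q′ q lq′ refl q′-open q-open =
    ∈-map⁺ (child q) (∈-allFin i)

  compact⇒atMostThreeMaxEmpty-below-open : Compact C → ∀ {q} → Open C q →
                                           AtMostThreeMaxEmpty C (suc (layer q))
  compact⇒atMostThreeMaxEmpty-below-open compact {q} q-open ps ps! maxEmpties =
    ≤-pred (Unique∧⊆⇒length≤ (qk∉ps ∷ ps!) qk∷ps⊆children)
    where
    k-contains : ∃ λ k → Contains C (child q k)
    k-contains = fractional⇒child-contains (proj₁ q-open)
    k : Fin 4
    k = proj₁ k-contains
    qk∉ps : All (child q k ≢_) ps
    qk∉ps = All.map (λ (_ , (_ , ¬contains) , _) qk≡p →
                       ¬contains (subst (Contains C) qk≡p (proj₂ k-contains)))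
                    maxEmpties
    qk∷ps⊆children : child q k ∷ ps ⊆ children q
    qk∷ps⊆children (here refl)  = ∈-map⁺ (child q) (∈-allFin k)
    qk∷ps⊆children (there p∈ps) =
      let (lp , mp) = All.lookup maxEmpties p∈ps in compact⇒maxEmpty∈children compact q-open lp mp

Unique∧layer≡0⇒length≤1 : ∀ {ps : List Pixel} → Unique ps → All (λ p → layer p ≡ 0) ps →
                          length ps ≤ 1
Unique∧layer≡0⇒length≤1 ps! roots =
  Unique∧⊆⇒length≤ {ys = [ [] ]} ps! (λ p∈ps → here (layer≡0⇒root (All.lookup roots p∈ps)))
  where
  layer≡0⇒root : ∀ {p} → layer p ≡ 0 → p ≡ []
  layer≡0⇒root {[]} _ = refl

lemma5 : (C : Config) → IsConfig C → Compact C → (j : ℕ) → AtMostThreeMaxEmpty C j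
lemma5 C _ compact zero    ps ps! maxEmpties =
  ≤-trans (Unique∧layer≡0⇒length≤1 ps! (All.map proj₁ maxEmpties)) (s≤s z≤n)
lemma5 C _ compact (suc j) []      _   _      = z≤n
lemma5 C _ compact (suc j) (p ∷ ps) ps! maxEmpties@((lp , mp) ∷ _)
  with maxEmpty⇒parent-open C lp mp
... | q , _ , _ , refl , q-open =
  compact⇒atMostThreeMaxEmpty-below-open C compact q-open (p ∷ ps) ps! maxEmpties
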